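{- Let $m$ be a positive integer and $\lambda$ a nonzero real number. For every $n\ge0$, $$D_{m,\lambda}(n,x)=\sum_{i=0}^{n}\binom{n}{i}m^{i}(1)_{n-i,\lambda}\,\mathrm{Bel}_{i,\lambda/m}\!\left(\frac{x}{m}\right).$$
   Context: For a nonzero real $\mu$: $(x)_{0,\mu}=1$, $(x)_{n,\mu}=x(x-\mu)\cdots(x-(n-1)\mu)$; $(x)_n=(x)_{n,1}$. Degenerate Stirling numbers of the second kind: $(x)_{n,\mu}=\sum_{k=0}^{n}S_{2,\mu}(n,k)(x)_{k}$; degenerate Bell polynomials: $\mathrm{Bel}_{n,\mu}(x)=\sum_{k=0}^{n}S_{2,\mu}(n,k)x^{k}$. Degenerate Whitney numbers of the second kind $W_{m,\lambda}(n,k)$: $(mx+1)_{n,\lambda}=\sum_{k=0}^{n}W_{m,\lambda}(n,k)m^{k}(x)_{k}$; degenerate Dowling polynomials $D_{m,\lambda}(n,x)=\sum_{k=0}^{n}W_{m,\lambda}(n,k)x^{k}$.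
   Formalization: The nonzero parameter λ is rational rather than real and the variable x is rational too, so the degenerate Stirling and Whitney numbers take values in ℚ. -}

module Defs where

open import Data.Nat using (ℕ; zero; suc)
open import Data.Integer using (+_)
open import Data.Rational using (ℚ; 0ℚ; 1ℚ; _+_; _*_; _-_; _/_)

ℕ→ℚ : ℕ → ℚ
ℕ→ℚ n = + n / 1

pow : ℚ → ℕ → ℚ
pow x zero    = 1ℚ
pow x (suc n) = pow x n * x

sumTo : ℕ → (ℕ → ℚ) → ℚ
sumTo zero    f = f 0
sumTo (suc n) f = sumTo n f + f (suc n)

fallingμ : ℚ → ℕ → ℚ → ℚ
fallingμ μ zero    x = 1ℚ
fallingμ μ (suc n) x = fallingμ μ n x * (x - ℕ→ℚ n * μ)

falling : ℕ → ℚ → ℚ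
falling n x = fallingμ 1ℚ n x

binom : ℕ → ℕ → ℚ
binom zero    zero    = 1ℚ
binom zero    (suc k) = 0ℚ
binom (suc n) zero    = 1ℚ
binom (suc n) (suc k) = binom n k + binom n (suc k)

-- degenerate Bell polynomial built from a table S of degenerate Stirling numbers
Bel : (ℕ → ℕ → ℚ) → ℕ → ℚ → ℚ
Bel S n x = sumTo n (λ k → S n k * pow x k)

-- degenerate Dowling polynomial built from a table W of degenerate Whitney numbers
Dowling : (ℕ → ℕ → ℚ) → ℕ → ℚ → ℚ
Dowling W n x = sumTo n (λ k → W n k * pow x k)

{-# OPTIONS --safe #-}

-- Expanding (m y + 1)_{n,λ} by the degenerate binomial theorem, rescaling
-- (m y)_{i,λ} = m^i (y)_{i,λ/m}, and expanding (y)_{i,λ/m} in falling factorials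
-- gives a second expansion of (m y + 1)_{n,λ} in the basis (y)_k.  The falling
-- factorials are linearly independent, so comparing coefficients yields
-- m^k W_{m,λ}(n,k) = Σ_i C(n,i) m^i (1)_{n-i,λ} S_{λ/m}(i,k).  Substituting this
-- into D_{m,λ}(n,x) = Σ_k m^k W_{m,λ}(n,k) (x/m)^k and exchanging the two sums
-- produces the Bell polynomials Bel_{i,λ/m}(x/m).

module Submission where

open import Defs
open import Data.Nat using (ℕ; NonZero; _∸_; zero; suc; _≤_; _<_; _≤?_; z≤n; s≤s)
open import Data.Integer using (+_)
open import Data.Rational using (ℚ; 0ℚ; 1ℚ; _+_; _*_; _/_; _-_; mkℚ; 1/_; ≢-nonZero; ↥_)
open import Relation.Binary.PropositionalEquality using (_≡_; _≢_; refl; sym; trans; cong; cong₂; module ≡-Reasoning)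

open import Data.Nat.Properties using (≤-refl; <⇒≤; <⇒≢; m≤n⇒m≤1+n; m≤n⇒m<n∨m≡n; m<n⇒m<1+n; +-∸-assoc; m+[n∸m]≡n; <⇒≱)
import Data.Nat as ℕ
import Data.Integer as ℤ
import Data.Integer.Properties as ℤ
open import Data.Nat.Coprimality using (1-coprimeTo) renaming (sym to coprime-sym)
open import Data.Rational.Properties
  using (+-*-commutativeRing; +-0-group; heytingCommutativeRing; _≟_; normalize-coprime;
         *-assoc; *-identityʳ; *-zeroˡ; *-zeroʳ; +-identityʳ; +-inverseʳ; *-distribˡ-+; *-distribʳ-+; +-assoc; *-inverseʳ; 1≢0)
open import Data.Sum using (inj₁; inj₂)
open import Data.Empty using (⊥-elim)
open import Function using (_∘_)
open import Level using (0ℓ)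
open import Relation.Nullary using (yes; no)
open import Relation.Nullary.Decidable using (dec⇒maybe)
open import Algebra.Properties.Group +-0-group using (x∙y⁻¹≈ε⇒x≈y; ∙-cancelˡ)
open import Algebra.Apartness.Properties.HeytingCommutativeRing heytingCommutativeRing using (x#0y#0→xy#0)
open import Tactic.RingSolver using (solve-∀)
import Tactic.RingSolver.Core.AlmostCommutativeRing as ACR

open ≡-Reasoning

ℚ-ring : ACR.AlmostCommutativeRing 0ℓ 0ℓ
ℚ-ring = ACR.fromCommutativeRing +-*-commutativeRing (dec⇒maybe ∘ (0ℚ ≟_))

ℕ→ℚ≡mkℚ : ∀ n → ℕ→ℚ n ≡ mkℚ (+ n) 0 (coprime-sym (1-coprimeTo n))
ℕ→ℚ≡mkℚ n = normalize-coprime _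

ℕ→ℚ-injective : ∀ {m n} → ℕ→ℚ m ≡ ℕ→ℚ n → m ≡ n
ℕ→ℚ-injective {m} {n} eq = ℤ.+-injective (cong ↥_ (trans (sym (ℕ→ℚ≡mkℚ m)) (trans eq (ℕ→ℚ≡mkℚ n))))

ℕ→ℚ-+ : ∀ m n → ℕ→ℚ (m ℕ.+ n) ≡ ℕ→ℚ m + ℕ→ℚ n
ℕ→ℚ-+ m n = begin
  + (m ℕ.+ n) / 1                   ≡⟨ cong (_/ 1) (sym (cong₂ ℤ._+_ (ℤ.*-identityʳ (+ m)) (ℤ.*-identityʳ (+ n)))) ⟩
  (+ m ℤ.* + 1 ℤ.+ + n ℤ.* + 1) / 1 ≡⟨ sym (cong₂ _+_ (ℕ→ℚ≡mkℚ m) (ℕ→ℚ≡mkℚ n)) ⟩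
  ℕ→ℚ m + ℕ→ℚ n                     ∎

ℕ→ℚ-*-cancel : ∀ m .{{_ : NonZero m}} u → ℕ→ℚ m * (u * (+ 1 / m)) ≡ u
ℕ→ℚ-*-cancel m@(suc _) u = begin
  ℕ→ℚ m * (u * (+ 1 / m)) ≡⟨ regroup (ℕ→ℚ m) u (+ 1 / m) ⟩
  u * (ℕ→ℚ m * (+ 1 / m)) ≡⟨ cong (u *_) m*1/m≡1 ⟩
  u * 1ℚ                  ≡⟨ *-identityʳ u ⟩
  u                       ∎
  where
  regroup : ∀ a u b → a * (u * b) ≡ u * (a * b)
  regroup = solve-∀ ℚ-ring
  m*1/m≡1 : ℕ→ℚ m * (+ 1 / m) ≡ 1ℚ
  m*1/m≡1 = trans (cong₂ _*_ (ℕ→ℚ≡mkℚ m) (normalize-coprime (1-coprimeTo m)))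
                  (*-inverseʳ (mkℚ (+ m) 0 (coprime-sym (1-coprimeTo m))))

sumTo-cong : ∀ n {f g : ℕ → ℚ} → (∀ k → k ≤ n → f k ≡ g k) → sumTo n f ≡ sumTo n g
sumTo-cong zero    eq = eq 0 z≤n
sumTo-cong (suc n) eq = cong₂ _+_ (sumTo-cong n (λ k k≤n → eq k (m≤n⇒m≤1+n k≤n))) (eq (suc n) ≤-refl)

sumTo-+ : ∀ n (f g : ℕ → ℚ) → sumTo n (λ k → f k + g k) ≡ sumTo n f + sumTo n g
sumTo-+ zero    f g = refl
sumTo-+ (suc n) f g = begin
  sumTo n (λ k → f k + g k) + (f (suc n) + g (suc n))   ≡⟨ cong (_+ (f (suc n) + g (suc n))) (sumTo-+ n f g) ⟩
  sumTo n f + sumTo n g + (f (suc n) + g (suc n))       ≡⟨ interchange (sumTo n f) (sumTo n g) (f (suc n)) (g (suc n)) ⟩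
  sumTo n f + f (suc n) + (sumTo n g + g (suc n))       ∎
  where
  interchange : ∀ a b c d → a + b + (c + d) ≡ a + c + (b + d)
  interchange = solve-∀ ℚ-ring

sumTo-*ˡ : ∀ n c (f : ℕ → ℚ) → sumTo n (λ k → c * f k) ≡ c * sumTo n f
sumTo-*ˡ zero    c f = refl
sumTo-*ˡ (suc n) c f = trans (cong (_+ c * f (suc n)) (sumTo-*ˡ n c f)) (sym (*-distribˡ-+ c (sumTo n f) (f (suc n))))

sumTo-*ʳ : ∀ n c (f : ℕ → ℚ) → sumTo n (λ k → f k * c) ≡ sumTo n f * c
sumTo-*ʳ zero    c f = refl
sumTo-*ʳ (suc n) c f = trans (cong (_+ f (suc n) * c) (sumTo-*ʳ n c f)) (sym (*-distribʳ-+ c (sumTo n f) (f (suc n))))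

sumTo-comm : ∀ m n (f : ℕ → ℕ → ℚ) →
             sumTo m (λ i → sumTo n (λ k → f i k)) ≡ sumTo n (λ k → sumTo m (λ i → f i k))
sumTo-comm zero    n f = refl
sumTo-comm (suc m) n f = trans (cong (_+ sumTo n (f (suc m))) (sumTo-comm m n f))
                               (sym (sumTo-+ n (λ k → sumTo m (λ i → f i k)) (f (suc m))))

sumTo-head : ∀ n (f : ℕ → ℚ) → sumTo (suc n) f ≡ f 0 + sumTo n (f ∘ suc)
sumTo-head zero    f = refl
sumTo-head (suc n) f = trans (cong (_+ f (suc (suc n))) (sumTo-head n f))
                             (+-assoc (f 0) (sumTo n (f ∘ suc)) (f (suc (suc n))))

sumTo-vanishing-tail : ∀ {i n} (f : ℕ → ℚ) → i ≤ n → (∀ k → i < k → k ≤ n → f k ≡ 0ℚ) →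
                       sumTo n f ≡ sumTo i f
sumTo-vanishing-tail {n = zero} f z≤n _ = refl
sumTo-vanishing-tail {i} {suc n} f i≤1+n tail with m≤n⇒m<n∨m≡n i≤1+n
... | inj₂ refl      = refl
... | inj₁ (s≤s i≤n) = begin
  sumTo n f + f (suc n) ≡⟨ cong₂ _+_ (sumTo-vanishing-tail f i≤n (λ k i<k k≤n → tail k i<k (m≤n⇒m≤1+n k≤n)))
                                     (tail (suc n) (s≤s i≤n) ≤-refl) ⟩
  sumTo i f + 0ℚ        ≡⟨ +-identityʳ (sumTo i f) ⟩
  sumTo i f             ∎

binom-n-0 : ∀ n → binom n 0 ≡ 1ℚ
binom-n-0 zero    = refl
binom-n-0 (suc n) = refl

binom-> : ∀ {n k} → n < k → binom n k ≡ 0ℚ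
binom-> {zero}  {suc k} _         = refl
binom-> {suc n} {suc k} (s≤s n<k) = cong₂ _+_ (binom-> n<k) (binom-> (m<n⇒m<1+n n<k))

sumTo-binom-pascal : ∀ n (f : ℕ → ℚ) →
  sumTo (suc n) (λ i → binom (suc n) i * f i)
    ≡ sumTo n (λ i → binom n i * f (suc i)) + sumTo n (λ i → binom n i * f i)
sumTo-binom-pascal n f = begin
  sumTo (suc n) (λ i → binom (suc n) i * f i)
    ≡⟨ sumTo-head n _ ⟩
  1ℚ * f 0 + sumTo n (λ i → (binom n i + binom n (suc i)) * f (suc i))
    ≡⟨ cong (_+_ (1ℚ * f 0)) (trans (sumTo-cong n (λ i _ → *-distribʳ-+ (f (suc i)) (binom n i) (binom n (suc i))))
                                 (sumTo-+ n _ _)) ⟩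
  1ℚ * f 0 + (L + R)
    ≡⟨ rotate (1ℚ * f 0) L R ⟩
  L + (1ℚ * f 0 + R)
    ≡⟨ cong (_+_ L) shifted ⟩
  L + sumTo n (λ i → binom n i * f i) ∎
  where
  L R : ℚ
  L = sumTo n (λ i → binom n i * f (suc i))
  R = sumTo n (λ i → binom n (suc i) * f (suc i))
  rotate : ∀ a b c → a + (b + c) ≡ b + (a + c)
  rotate = solve-∀ ℚ-ring
  shifted : 1ℚ * f 0 + R ≡ sumTo n (λ i → binom n i * f i)
  shifted = begin
    1ℚ * f 0 + R                     ≡⟨ cong (λ b → b * f 0 + R) (sym (binom-n-0 n)) ⟩
    binom n 0 * f 0 + R              ≡⟨ sym (sumTo-head n _) ⟩
    S + binom n (suc n) * f (suc n)  ≡⟨ cong (λ b → S + b * f (suc n)) (binom-> {n} ≤-refl) ⟩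
    S + 0ℚ * f (suc n)               ≡⟨ cong (_+_ S) (*-zeroˡ (f (suc n))) ⟩
    S + 0ℚ                           ≡⟨ +-identityʳ S ⟩
    S                                ∎
    where
    S : ℚ
    S = sumTo n (λ i → binom n i * f i)

fallingμ-binomial : ∀ μ n y z →
  fallingμ μ n (y + z) ≡ sumTo n (λ i → binom n i * (fallingμ μ i y * fallingμ μ (n ∸ i) z))
fallingμ-binomial μ zero    y z = refl
fallingμ-binomial μ (suc n) y z = begin
  fallingμ μ n (y + z) * d
    ≡⟨ cong (_* d) (fallingμ-binomial μ n y z) ⟩
  sumTo n (λ i → binom n i * (a i * b (n ∸ i))) * d
    ≡⟨ sym (sumTo-*ʳ n d _) ⟩
  sumTo n (λ i → binom n i * (a i * b (n ∸ i)) * d)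
    ≡⟨ sumTo-cong n split ⟩
  sumTo n (λ i → binom n i * f (suc i) + binom n i * f i)
    ≡⟨ sumTo-+ n _ _ ⟩
  sumTo n (λ i → binom n i * f (suc i)) + sumTo n (λ i → binom n i * f i)
    ≡⟨ sym (sumTo-binom-pascal n f) ⟩
  sumTo (suc n) (λ i → binom (suc n) i * f i) ∎
  where
  a b f : ℕ → ℚ
  a i = fallingμ μ i y
  b j = fallingμ μ j z
  f i = a i * b (suc n ∸ i)
  d : ℚ
  d = y + z - ℕ→ℚ n * μ
  distribute : ∀ c u v p q y z μ → c * (u * v) * (y + z - (p + q) * μ)
                                   ≡ c * (u * (y - p * μ) * v) + c * (u * (v * (z - q * μ)))
  distribute = solve-∀ ℚ-ring
  split : ∀ i → i ≤ n → binom n i * (a i * b (n ∸ i)) * d ≡ binom n i * f (suc i) + binom n i * f i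
  split i i≤n = begin
    binom n i * (a i * b (n ∸ i)) * d
      ≡⟨ cong (λ t → binom n i * (a i * b (n ∸ i)) * (y + z - t * μ))
              (trans (cong ℕ→ℚ (sym (m+[n∸m]≡n i≤n))) (ℕ→ℚ-+ i (n ∸ i))) ⟩
    binom n i * (a i * b (n ∸ i)) * (y + z - (ℕ→ℚ i + ℕ→ℚ (n ∸ i)) * μ)
      ≡⟨ distribute (binom n i) (a i) (b (n ∸ i)) (ℕ→ℚ i) (ℕ→ℚ (n ∸ i)) y z μ ⟩
    binom n i * f (suc i) + binom n i * (a i * b (suc (n ∸ i)))
      ≡⟨ cong (λ j → binom n i * f (suc i) + binom n i * (a i * b j)) (sym (+-∸-assoc 1 i≤n)) ⟩
    binom n i * f (suc i) + binom n i * f i ∎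

fallingμ-scale : ∀ c μ n y → fallingμ (c * μ) n (c * y) ≡ pow c n * fallingμ μ n y
fallingμ-scale c μ zero    y = sym (*-identityʳ 1ℚ)
fallingμ-scale c μ (suc n) y = begin
  fallingμ (c * μ) n (c * y) * (c * y - ℕ→ℚ n * (c * μ))    ≡⟨ cong (_* (c * y - ℕ→ℚ n * (c * μ))) (fallingμ-scale c μ n y) ⟩
  pow c n * fallingμ μ n y * (c * y - ℕ→ℚ n * (c * μ))      ≡⟨ factor-out (pow c n) (fallingμ μ n y) c y (ℕ→ℚ n) μ ⟩
  pow c n * c * (fallingμ μ n y * (y - ℕ→ℚ n * μ))          ∎
  where
  factor-out : ∀ p u c y k μ → p * u * (c * y - k * (c * μ)) ≡ p * c * (u * (y - k * μ))
  factor-out = solve-∀ ℚ-ring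

pow-* : ∀ a b n → pow (a * b) n ≡ pow a n * pow b n
pow-* a b zero    = sym (*-identityʳ 1ℚ)
pow-* a b (suc n) = trans (cong (_* (a * b)) (pow-* a b n)) (interchange (pow a n) (pow b n) a b)
  where
  interchange : ∀ p q a b → p * q * (a * b) ≡ p * a * (q * b)
  interchange = solve-∀ ℚ-ring

*-cancelʳ-≢0 : ∀ {a b} c → c ≢ 0ℚ → a * c ≡ b * c → a ≡ b
*-cancelʳ-≢0 {a} {b} c c≢0 eq = begin
  a              ≡⟨ sym (undo a) ⟩
  a * c * (1/ c) ≡⟨ cong (_* (1/ c)) eq ⟩
  b * c * (1/ c) ≡⟨ undo b ⟩
  b              ∎
  where
  instance _ = ≢-nonZero c≢0
  undo : ∀ x → x * c * (1/ c) ≡ x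
  undo x = trans (*-assoc x c (1/ c)) (trans (cong (x *_) (*-inverseʳ c)) (*-identityʳ x))

falling-vanishes : ∀ {j k} → j < k → falling k (ℕ→ℚ j) ≡ 0ℚ
falling-vanishes {j} {suc k} (s≤s j≤k) with m≤n⇒m<n∨m≡n j≤k
... | inj₁ j<k  = trans (cong (_* factor) (falling-vanishes j<k)) (*-zeroˡ factor)
  where
  factor : ℚ
  factor = ℕ→ℚ j - ℕ→ℚ k * 1ℚ
... | inj₂ refl = trans (cong (falling j (ℕ→ℚ j) *_) (trans (cong (ℕ→ℚ j -_) (*-identityʳ (ℕ→ℚ j))) (+-inverseʳ (ℕ→ℚ j))))
                        (*-zeroʳ (falling j (ℕ→ℚ j)))

falling-nonzero : ∀ {j k} → k ≤ j → falling k (ℕ→ℚ j) ≢ 0ℚ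
falling-nonzero {k = zero}      _   = 1≢0
falling-nonzero {j} {k = suc k} k<j = x#0y#0→xy#0 (falling-nonzero (<⇒≤ k<j)) factor≢0
  where
  factor≢0 : ℕ→ℚ j - ℕ→ℚ k * 1ℚ ≢ 0ℚ
  factor≢0 eq = <⇒≢ k<j (sym (ℕ→ℚ-injective (trans (x∙y⁻¹≈ε⇒x≈y _ _ eq) (*-identityʳ (ℕ→ℚ k)))))

-- At x = j the terms with k > j vanish and (j)_j ≠ 0, so the coefficients are
-- determined one at a time in increasing k.
falling-coeff-unique : ∀ n (a b : ℕ → ℚ) →
  (∀ x → sumTo n (λ k → a k * falling k x) ≡ sumTo n (λ k → b k * falling k x)) →
  ∀ k → k ≤ n → a k ≡ b k
falling-coeff-unique n a b eq k k≤n = agree k≤n ≤-refl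
  where
  at : ∀ {j} → j ≤ n → sumTo j (λ k → a k * falling k (ℕ→ℚ j)) ≡ sumTo j (λ k → b k * falling k (ℕ→ℚ j))
  at {j} j≤n = trans (sym (truncate a)) (trans (eq (ℕ→ℚ j)) (truncate b))
    where
    truncate : ∀ c → sumTo n (λ k → c k * falling k (ℕ→ℚ j)) ≡ sumTo j (λ k → c k * falling k (ℕ→ℚ j))
    truncate c = sumTo-vanishing-tail _ j≤n (λ k j<k _ → trans (cong (c k *_) (falling-vanishes j<k)) (*-zeroʳ (c k)))
  agree : ∀ {j} → j ≤ n → ∀ {k} → k ≤ j → a k ≡ b k
  agree {zero}  j≤n {zero} z≤n = trans (sym (*-identityʳ (a 0))) (trans (at j≤n) (*-identityʳ (b 0)))
  agree {suc j} j≤n {k} k≤j with m≤n⇒m<n∨m≡n k≤j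
  ... | inj₁ (s≤s k≤j-1) = agree (<⇒≤ j≤n) k≤j-1
  ... | inj₂ refl        = *-cancelʳ-≢0 (falling (suc j) x) (falling-nonzero {suc j} ≤-refl)
                             (∙-cancelˡ (sumTo j (term b)) _ _ (trans (cong (_+ term a (suc j)) (sym lower)) (at j≤n)))
    where
    x : ℚ
    x = ℕ→ℚ (suc j)
    term : (ℕ → ℚ) → ℕ → ℚ
    term c k = c k * falling k x
    lower : sumTo j (term a) ≡ sumTo j (term b)
    lower = sumTo-cong j (λ i i≤j → cong (_* falling i x) (agree (<⇒≤ j≤n) i≤j))

-- The Stirling numbers S_μ(i,k) with k > i are not constrained by their defining
-- identity, so rows are cut off at i before summing over all k ≤ n.
zeroAbove : ℕ → (ℕ → ℚ) → ℕ → ℚ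
zeroAbove i f k with k ≤? i
... | yes _ = f k
... | no  _ = 0ℚ

zeroAbove-≤ : ∀ {i k} (f : ℕ → ℚ) → k ≤ i → zeroAbove i f k ≡ f k
zeroAbove-≤ {i} {k} f k≤i with k ≤? i
... | yes _  = refl
... | no k≰i = ⊥-elim (k≰i k≤i)

zeroAbove-> : ∀ {i k} (f : ℕ → ℚ) → i < k → zeroAbove i f k ≡ 0ℚ
zeroAbove-> {i} {k} f i<k with k ≤? i
... | yes k≤i = ⊥-elim (<⇒≱ i<k k≤i)
... | no _    = refl

sumTo-zeroAbove : ∀ {i n} (f g : ℕ → ℚ) → i ≤ n →
                  sumTo n (λ k → zeroAbove i f k * g k) ≡ sumTo i (λ k → f k * g k)
sumTo-zeroAbove {i} {n} f g i≤n = begin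
  sumTo n (λ k → zeroAbove i f k * g k)
    ≡⟨ sumTo-vanishing-tail _ i≤n (λ k i<k _ → trans (cong (_* g k) (zeroAbove-> f i<k)) (*-zeroˡ (g k))) ⟩
  sumTo i (λ k → zeroAbove i f k * g k)
    ≡⟨ sumTo-cong i (λ k k≤i → cong (_* g k) (zeroAbove-≤ f k≤i)) ⟩
  sumTo i (λ k → f k * g k) ∎

sumTo-triangular : ∀ n (c : ℕ → ℚ) (S : ℕ → ℕ → ℚ) (g : ℕ → ℚ) →
  sumTo n (λ i → c i * sumTo i (λ k → S i k * g k))
    ≡ sumTo n (λ k → sumTo n (λ i → c i * zeroAbove i (S i) k) * g k)
sumTo-triangular n c S g = begin
  sumTo n (λ i → c i * sumTo i (λ k → S i k * g k))
    ≡⟨ sumTo-cong n (λ i i≤n → cong (c i *_) (sym (sumTo-zeroAbove (S i) g i≤n))) ⟩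
  sumTo n (λ i → c i * sumTo n (λ k → Z i k * g k))
    ≡⟨ sumTo-cong n (λ i _ → sym (sumTo-*ˡ n (c i) _)) ⟩
  sumTo n (λ i → sumTo n (λ k → c i * (Z i k * g k)))
    ≡⟨ sumTo-comm n n _ ⟩
  sumTo n (λ k → sumTo n (λ i → c i * (Z i k * g k)))
    ≡⟨ sumTo-cong n (λ k _ → trans (sumTo-cong n (λ i _ → sym (*-assoc (c i) (Z i k) (g k)))) (sumTo-*ʳ n (g k) _)) ⟩
  sumTo n (λ k → sumTo n (λ i → c i * Z i k) * g k) ∎
  where
  Z : ℕ → ℕ → ℚ
  Z i = zeroAbove i (S i)

Dowling-scale : ∀ W n a u → Dowling W n (a * u) ≡ sumTo n (λ k → W n k * pow a k * pow u k)
Dowling-scale W n a u = sumTo-cong n (λ k _ → trans (cong (W n k *_) (pow-* a u k)) (sym (*-assoc (W n k) _ _)))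

whitney-coeff-expansion : ∀ {lam} M μ → M * μ ≡ lam → (S : ℕ → ℕ → ℚ) →
  (∀ i y → fallingμ μ i y ≡ sumTo i (λ k → S i k * falling k y)) →
  ∀ n (w : ℕ → ℚ) → (∀ y → fallingμ lam n (M * y + 1ℚ) ≡ sumTo n (λ k → w k * pow M k * falling k y)) →
  ∀ k → k ≤ n → w k * pow M k ≡ sumTo n (λ i → binom n i * pow M i * fallingμ lam (n ∸ i) 1ℚ * zeroAbove i (S i) k)
whitney-coeff-expansion {lam} M μ M*μ≡lam S S-def n w w-def = falling-coeff-unique n _ _ λ y → begin
  sumTo n (λ k → w k * pow M k * falling k y)                                   ≡⟨ sym (w-def y) ⟩
  fallingμ lam n (M * y + 1ℚ)                                                   ≡⟨ fallingμ-binomial lam n (M * y) 1ℚ ⟩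
  sumTo n (λ i → binom n i * (fallingμ lam i (M * y) * fallingμ lam (n ∸ i) 1ℚ)) ≡⟨ sumTo-cong n (λ i _ → rescale i y) ⟩
  sumTo n (λ i → c i * fallingμ μ i y)                                          ≡⟨ sumTo-cong n (λ i _ → cong (c i *_) (S-def i y)) ⟩
  sumTo n (λ i → c i * sumTo i (λ k → S i k * falling k y))                     ≡⟨ sumTo-triangular n c S (λ k → falling k y) ⟩
  sumTo n (λ k → sumTo n (λ i → c i * zeroAbove i (S i) k) * falling k y)       ∎
  where
  c : ℕ → ℚ
  c i = binom n i * pow M i * fallingμ lam (n ∸ i) 1ℚ
  rescale : ∀ i y → binom n i * (fallingμ lam i (M * y) * fallingμ lam (n ∸ i) 1ℚ) ≡ c i * fallingμ μ i y
  rescale i y = begin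
    binom n i * (fallingμ lam i (M * y) * fallingμ lam (n ∸ i) 1ℚ)
      ≡⟨ cong (λ l → binom n i * (fallingμ l i (M * y) * fallingμ lam (n ∸ i) 1ℚ)) (sym M*μ≡lam) ⟩
    binom n i * (fallingμ (M * μ) i (M * y) * fallingμ lam (n ∸ i) 1ℚ)
      ≡⟨ cong (λ t → binom n i * (t * fallingμ lam (n ∸ i) 1ℚ)) (fallingμ-scale M μ i y) ⟩
    binom n i * (pow M i * fallingμ μ i y * fallingμ lam (n ∸ i) 1ℚ)
      ≡⟨ regroup (binom n i) (pow M i) (fallingμ μ i y) (fallingμ lam (n ∸ i) 1ℚ) ⟩
    c i * fallingμ μ i y ∎
    where
    regroup : ∀ b p u v → b * (p * u * v) ≡ b * p * v * u
    regroup = solve-∀ ℚ-ring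

theorem23 : (m : ℕ) → .{{_ : NonZero m}} → (lam : ℚ) → lam ≢ 0ℚ →
            (S : ℚ → ℕ → ℕ → ℚ) →
            (∀ μ → μ ≢ 0ℚ → ∀ n x →
               fallingμ μ n x ≡ sumTo n (λ k → S μ n k * falling k x)) →
            (W : ℕ → ℕ → ℚ) →
            (∀ n x →
               fallingμ lam n (ℕ→ℚ m * x + 1ℚ)
                 ≡ sumTo n (λ k → W n k * pow (ℕ→ℚ m) k * falling k x)) →
            ∀ n x →
              Dowling W n x
                ≡ sumTo n (λ i → binom n i * pow (ℕ→ℚ m) i * fallingμ lam (n ∸ i) 1ℚ
                                 * Bel (S (lam * (+ 1 / m))) i (x * (+ 1 / m)))
theorem23 m lam lam≢0 S S-def W W-def n x = begin
  Dowling W n x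
    ≡⟨ cong (Dowling W n) (sym (ℕ→ℚ-*-cancel m x)) ⟩
  Dowling W n (M * (x * r))
    ≡⟨ Dowling-scale W n M (x * r) ⟩
  sumTo n (λ k → W n k * pow M k * pow (x * r) k)
    ≡⟨ sumTo-cong n (λ k k≤n → cong (_* pow (x * r) k) (coeff k k≤n)) ⟩
  sumTo n (λ k → sumTo n (λ i → c i * zeroAbove i (S μ i) k) * pow (x * r) k)
    ≡⟨ sym (sumTo-triangular n c (S μ) (pow (x * r))) ⟩
  sumTo n (λ i → c i * Bel (S μ) i (x * r)) ∎
  where
  M r μ : ℚ
  M = ℕ→ℚ m
  r = + 1 / m
  μ = lam * r
  c : ℕ → ℚ
  c i = binom n i * pow M i * fallingμ lam (n ∸ i) 1ℚ
  μ≢0 : μ ≢ 0ℚ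
  μ≢0 μ≡0 = lam≢0 (trans (sym (ℕ→ℚ-*-cancel m lam)) (trans (cong (M *_) μ≡0) (*-zeroʳ M)))
  coeff : ∀ k → k ≤ n → W n k * pow M k ≡ sumTo n (λ i → c i * zeroAbove i (S μ i) k)
  coeff = whitney-coeff-expansion M μ (ℕ→ℚ-*-cancel m lam) (S μ) (S-def μ μ≢0) n (W n) (W-def n)
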